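{- Let $m<n$ be positive integers and let $a,b,c\in\{1,\ldots,m\}^*$ be words. Then $a\,m\,b\,n\,c\sim a\,n\,b\,m\,c$.
   Context: $\mathbb{P}$ is the positive integers; $\mathbb{P}^*$ the finite words over $\mathbb{P}$, juxtaposition is concatenation. Generalized factor order: $u\le w$ iff there is a factor $w'$ of $w$ (consecutive letters) with $|w'|=|u|$ and $u_i\le w'_i$ for all $i$. The weight of $w=w_1\cdots w_\ell$ is $t^\ell x^{w_1+\cdots+w_\ell}$ and $F(u;t,x)=\sum_{w\ge u}\mathrm{wt}(w)$. $u\sim v$ (Wilf equivalence) means $F(u;t,x)=F(v;t,x)$. -}

module Defs where

open import Data.Nat using (ℕ; zero; suc; _∸_; _≤ᵇ_; _≤_; _<_)
open import Data.Bool using (Bool; true; false; _∧_; _∨_)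
open import Data.List using (List; []; _∷_; length; map; concatMap; upTo; filterᵇ; _++_)
open import Data.List.Relation.Unary.All using (All)
open import Data.Product using (_×_)
open import Relation.Binary.PropositionalEquality using (_≡_)

InRange : ℕ → List ℕ → Set
InRange m w = All (λ x → 1 ≤ x × x ≤ m) w

prefixLe : List ℕ → List ℕ → Bool
prefixLe []       _        = true
prefixLe (_ ∷ _)  []       = false
prefixLe (x ∷ u)  (y ∷ w)  = (x ≤ᵇ y) ∧ prefixLe u w

-- Generalized factor order: u ≤ w iff some factor w' of w with |w'| = |u|
-- satisfies u_i ≤ w'_i for all i (the factor starts at some position of w).
factorLe : List ℕ → List ℕ → Bool
factorLe u []       = prefixLe u []
factorLe u (y ∷ w)  = prefixLe u (y ∷ w) ∨ factorLe u w

words : ℕ → ℕ → List (List ℕ)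
words zero    zero    = [] ∷ []
words zero    (suc s) = []
words (suc ℓ) s       = concatMap (λ k → map (k ∷_) (words ℓ (s ∸ k))) (map suc (upTo s))

-- Coefficient of t^ℓ x^s in F(u;t,x) = Σ_{w ≥ u} t^{|w|} x^{Σ w}.
coeffF : List ℕ → ℕ → ℕ → ℕ
coeffF u ℓ s = length (filterᵇ (factorLe u) (words ℓ s))

-- Wilf equivalence: F(u;t,x) = F(v;t,x) as formal power series, i.e. all coefficients agree.
WilfEquiv : List ℕ → List ℕ → Set
WilfEquiv u v = ∀ ℓ s → coeffF u ℓ s ≡ coeffF v ℓ s

-- A position p of a word w is an anchor if a m b m c occurs in w with its two distinguished
-- letters at p and p + d, where d = |b| + 1; both letters are then ≥ m. Since every letter of
-- a, b, c is ≤ m, permuting letters ≥ m among positions carrying letters ≥ m changes no anchor.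
-- Anchors p, p + d, …, p + (t − 1)d form chains covering p, p + d, …, p + td, and reversing w along
-- every chain is therefore an involution φ preserving length, letter sum and anchors. An occurrence
-- of a n b m c in w is an anchor whose first letter is ≥ n; reversal moves that letter to the
-- second slot of the mirrored anchor, giving an occurrence of a m b n c in φ w, and conversely.
-- So φ maps the words counted by one coefficient bijectively onto those counted by the other.
module Submission where

open import Defs
open import Data.Nat using (ℕ; _≤_; _<_)
open import Data.List using (List; _∷_; _++_)

open import Data.Nat
open import Data.Nat.Properties
open import Data.Nat.ListAction using (sum)
open import Data.Nat.ListAction.Properties using (sum-↭)
open import Data.Bool using (Bool; true; false; if_then_else_; T; _∧_)
open import Data.Bool.Properties using (T?; T-∧; T-∨)
open import Data.Empty using (⊥; ⊥-elim)
open import Data.Product using (_×_; _,_; proj₁; proj₂; ∃; ∃₂)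
open import Data.Sum using (_⊎_; inj₁; inj₂)
open import Data.List using ([]; map; length; drop; applyUpTo; upTo; concatMap; filterᵇ)
open import Data.List.Properties using (length-applyUpTo; map-upTo; map-∘; ++-assoc; length-++; length-drop)
open import Data.List.Membership.Propositional using (_∈_; find; lose)
open import Data.List.Membership.Propositional.Properties
  using (∈-map⁺; ∈-map⁻; ∈-concatMap⁺; ∈-concatMap⁻; ∈-upTo⁺; ∈-upTo⁻)
open import Data.List.Membership.Propositional.Properties.WithK using (unique∧set⇒bag)
open import Data.List.Relation.Binary.BagAndSetEquality using (∼bag⇒↭)
open import Data.List.Relation.Binary.Permutation.Propositional using (_↭_; ↭-sym)
open import Data.List.Relation.Binary.Permutation.Propositional.Properties
  using (↭-length; filter-↭; All-resp-↭) renaming (map⁺ to ↭-map⁺)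
open import Data.List.Relation.Unary.All as All using (All; []; _∷_)
open import Data.List.Relation.Unary.All.Properties using (++⁺)
open import Data.List.Relation.Unary.Any using (here)
open import Data.List.Relation.Unary.Unique.Propositional using (Unique; []; _∷_)
import Data.List.Relation.Unary.Unique.Propositional.Properties as Unique
open import Function using (_∘_)
open import Function.Bundles using (mk⇔; Equivalence)
open import Relation.Nullary using (¬_; yes; no)
open import Relation.Binary.PropositionalEquality

module _ {A : Set} where

  involution-↭ : ∀ {f : A → A} {xs} → Unique xs → (∀ x → f (f x) ≡ x) →
                 (∀ {x} → x ∈ xs → f x ∈ xs) → map f xs ↭ xs
  involution-↭ {f} {xs} uniq invol closed =
    ∼bag⇒↭ (unique∧set⇒bag (Unique.map⁺ injective uniq) uniq (mk⇔ to from))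
    where
    injective : ∀ {x y} → f x ≡ f y → x ≡ y
    injective {x} {y} e = trans (sym (invol x)) (trans (cong f e) (invol y))
    to : ∀ {x} → x ∈ map f xs → x ∈ xs
    to x∈ with _ , y∈ , refl ← ∈-map⁻ f x∈ = closed y∈
    from : ∀ {x} → x ∈ xs → x ∈ map f xs
    from {x} x∈ = subst (_∈ map f xs) (invol x) (∈-map⁺ f (closed x∈))

  length-filterᵇ-map : ∀ {p q : A → Bool} {f : A → A} → (∀ x → p (f x) ≡ q x) →
                       ∀ xs → length (filterᵇ p (map f xs)) ≡ length (filterᵇ q xs)
  length-filterᵇ-map         pf≗q []       = refl
  length-filterᵇ-map {q = q} pf≗q (x ∷ xs) rewrite pf≗q x with q x
  ... | true  = cong suc (length-filterᵇ-map pf≗q xs)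
  ... | false = length-filterᵇ-map pf≗q xs

  count-invariant : ∀ {p q : A → Bool} {f : A → A} {xs} → map f xs ↭ xs → (∀ x → p (f x) ≡ q x) →
                    length (filterᵇ p xs) ≡ length (filterᵇ q xs)
  count-invariant {p} {q} {f} {xs} fxs↭xs pf≗q =
    trans (↭-length (filter-↭ (T? ∘ p) (↭-sym fxs↭xs))) (length-filterᵇ-map {p} {q} {f} pf≗q xs)

prepend : {A : Set} → (A → List (List A)) → List A → List (List A)
prepend g = concatMap (λ h → map (h ∷_) (g h))

module _ {A : Set} (g : A → List (List A)) where

  ∈-prepend⁻ : ∀ hs {w} → w ∈ prepend g hs →
               ∃₂ λ h t → h ∈ hs × t ∈ g h × w ≡ h ∷ t
  ∈-prepend⁻ hs w∈ with h , h∈ , w∈h ← find (∈-concatMap⁻ _ {xs = hs} w∈)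
                    with t , t∈ , refl ← ∈-map⁻ _ w∈h = h , t , h∈ , t∈ , refl

  ∈-prepend⁺ : ∀ {hs h t} → h ∈ hs → t ∈ g h → h ∷ t ∈ prepend g hs
  ∈-prepend⁺ {hs} h∈ t∈ = ∈-concatMap⁺ _ {xs = hs} (lose h∈ (∈-map⁺ _ t∈))

  prepend-unique : ∀ {hs} → Unique hs → (∀ h → Unique (g h)) →
                   Unique (prepend g hs)
  prepend-unique []                   _  = []
  prepend-unique {h ∷ hs} (h∉ ∷ uniq) ug =
    Unique.++⁺ (Unique.map⁺ (λ { refl → refl }) (ug h)) (prepend-unique uniq ug) disjoint
    where
    disjoint : ∀ {w} → w ∈ map (h ∷_) (g h) × w ∈ prepend g hs → ⊥
    disjoint (w∈ , w∈′)
      with _ , _ , refl ← ∈-map⁻ _ w∈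
      with _ , _ , h′∈ , _ , refl ← ∈-prepend⁻ hs w∈′ =
      All.lookup h∉ h′∈ refl

words-unique : ∀ ℓ s → Unique (words ℓ s)
words-unique zero    zero    = [] ∷ []
words-unique zero    (suc s) = []
words-unique (suc ℓ) s       =
  prepend-unique (λ h → words ℓ (s ∸ h)) (Unique.map⁺ suc-injective (Unique.upTo⁺ s))
                 (λ h → words-unique ℓ (s ∸ h))

∈-words⁻ : ∀ ℓ s {w} → w ∈ words ℓ s → length w ≡ ℓ × sum w ≡ s × All (1 ≤_) w
∈-words⁻ zero    zero    (here refl) = refl , refl , []
∈-words⁻ (suc ℓ) s       w∈
  with _ , t , h∈ , t∈ , refl ← ∈-prepend⁻ (λ h → words ℓ (s ∸ h)) (map suc (upTo s)) w∈
  with y , y∈ , refl ← ∈-map⁻ suc h∈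
  with len , Σt , pos ← ∈-words⁻ ℓ (s ∸ suc y) t∈ =
  cong suc len , trans (cong (suc y +_) Σt) (m+[n∸m]≡n (∈-upTo⁻ y∈)) , s≤s z≤n ∷ pos

∈-words⁺ : ∀ {w} → All (1 ≤_) w → w ∈ words (length w) (sum w)
∈-words⁺ []                          = here refl
∈-words⁺ {suc y ∷ t} (s≤s z≤n ∷ pos) =
  ∈-prepend⁺ (λ h → words (length t) (suc y + sum t ∸ h))
             (∈-map⁺ suc (∈-upTo⁺ (s≤s (m≤m+n y (sum t)))))
             (subst (λ s → t ∈ words (length t) s) (sym (m+n∸m≡n (suc y) (sum t))) (∈-words⁺ pos))

words-↭ : ∀ {ℓ s v w} → v ↭ w → w ∈ words ℓ s → v ∈ words ℓ s
words-↭ {ℓ} {s} {v} v↭w w∈ with len , Σw , pos ← ∈-words⁻ ℓ s w∈ =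
  subst₂ (λ ℓ s → v ∈ words ℓ s) (trans (↭-length v↭w) len) (trans (sum-↭ v↭w) Σw)
         (∈-words⁺ (All-resp-↭ (↭-sym v↭w) pos))

-- Out-of-range positions read as 0, which is not a letter.
at : List ℕ → ℕ → ℕ
at []       _       = 0
at (x ∷ xs) zero    = x
at (x ∷ xs) (suc j) = at xs j

at-drop : ∀ i ws j → at (drop i ws) j ≡ at ws (i + j)
at-drop zero    ws       j = refl
at-drop (suc i) []       j = refl
at-drop (suc i) (x ∷ ws) j = at-drop i ws j

at-beyond : ∀ ws {j} → length ws ≤ j → at ws j ≡ 0
at-beyond []       _         = refl
at-beyond (x ∷ ws) (s≤s len≤j) = at-beyond ws len≤j

at-positive : ∀ ws j → 1 ≤ at ws j → j < length ws
at-positive (x ∷ ws) zero    _ = s≤s z≤n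
at-positive (x ∷ ws) (suc j) p = s≤s (at-positive ws j p)

at-applyUpTo : ∀ (f : ℕ → ℕ) {n j} → j < n → at (applyUpTo f n) j ≡ f j
at-applyUpTo f {suc n} {zero}  _         = refl
at-applyUpTo f {suc n} {suc j} (s≤s j<n) = at-applyUpTo (f ∘ suc) j<n

applyUpTo-at : ∀ ws → applyUpTo (at ws) (length ws) ≡ ws
applyUpTo-at []       = refl
applyUpTo-at (x ∷ ws) = cong (x ∷_) (applyUpTo-at ws)

applyUpTo-cong : ∀ {f g : ℕ → ℕ} n → (∀ {j} → j < n → f j ≡ g j) → applyUpTo f n ≡ applyUpTo g n
applyUpTo-cong zero    _   = refl
applyUpTo-cong (suc n) f≗g = cong₂ _∷_ (f≗g (s≤s z≤n)) (applyUpTo-cong n (f≗g ∘ s≤s))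

permute : (ℕ → ℕ) → List ℕ → List ℕ
permute π w = applyUpTo (at w ∘ π) (length w)

length-permute : ∀ π w → length (permute π w) ≡ length w
length-permute π w = length-applyUpTo (at w ∘ π) (length w)

at-permute : ∀ π w {j} → j < length w → at (permute π w) j ≡ at w (π j)
at-permute π w = at-applyUpTo (at w ∘ π)

permute-cong : ∀ {π π′} → (∀ j → π j ≡ π′ j) → ∀ w → permute π w ≡ permute π′ w
permute-cong π≗π′ w = applyUpTo-cong (length w) (λ {j} _ → cong (at w) (π≗π′ j))

module _ {π : ℕ → ℕ} {w : List ℕ} (invol : ∀ j → π (π j) ≡ j)
         (π-< : ∀ {j} → j < length w → π j < length w) where

  permute-involutive : permute π (permute π w) ≡ w
  permute-involutive = begin
    applyUpTo (at (permute π w) ∘ π) (length (permute π w))  ≡⟨ cong (applyUpTo _) (length-permute π w) ⟩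
    applyUpTo (at (permute π w) ∘ π) (length w)              ≡⟨ applyUpTo-cong (length w) back ⟩
    applyUpTo (at w) (length w)                              ≡⟨ applyUpTo-at w ⟩
    w                                                        ∎
    where
    open ≡-Reasoning
    back : ∀ {j} → j < length w → at (permute π w) (π j) ≡ at w j
    back {j} j< = trans (at-permute π w (π-< j<)) (cong (at w) (invol j))

  permute-↭ : permute π w ↭ w
  permute-↭ = subst₂ _↭_ (trans (sym (map-∘ (upTo N))) (map-upTo (at w ∘ π) N))
                         (trans (map-upTo (at w) N) (applyUpTo-at w))
                         (↭-map⁺ (at w) (involution-↭ (Unique.upTo⁺ N) invol (∈-upTo⁺ ∘ π-< ∘ ∈-upTo⁻)))
    where N = length w

T-ext : ∀ {x y} → (T x → T y) → (T y → T x) → x ≡ y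
T-ext {false} {false} _ _ = refl
T-ext {false} {true}  _ g = ⊥-elim (g _)
T-ext {true}  {false} f _ = ⊥-elim (f _)
T-ext {true}  {true}  _ _ = refl

prefixLe-at : ∀ p {y q ws} → T (prefixLe (p ++ y ∷ q) ws) → y ≤ at ws (length p)
prefixLe-at []      {ws = w ∷ ws} h = ≤ᵇ⇒≤ _ _ (proj₁ (Equivalence.to T-∧ h))
prefixLe-at (x ∷ p) {ws = w ∷ ws} h = prefixLe-at p (proj₂ (Equivalence.to T-∧ h))

prefixLe-replace : ∀ p {y z q ws} → T (prefixLe (p ++ z ∷ q) ws) → y ≤ at ws (length p) →
                   T (prefixLe (p ++ y ∷ q) ws)
prefixLe-replace []      {ws = w ∷ ws} h y≤ =
  Equivalence.from T-∧ (≤⇒≤ᵇ y≤ , proj₂ (Equivalence.to T-∧ h))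
prefixLe-replace (x ∷ p) {ws = w ∷ ws} h y≤ =
  Equivalence.from T-∧ (proj₁ (Equivalence.to T-∧ h) , prefixLe-replace p (proj₂ (Equivalence.to T-∧ h)) y≤)

AgreeAbove : ℕ → List ℕ → List ℕ → Set
AgreeAbove M ws ws′ = ∀ j → at ws j ≡ at ws′ j ⊎ (M ≤ at ws j × M ≤ at ws′ j)

AgreeAbove-drop : ∀ {M ws ws′} i → AgreeAbove M ws ws′ → AgreeAbove M (drop i ws) (drop i ws′)
AgreeAbove-drop {M} {ws} {ws′} i agree j
  rewrite at-drop i ws j | at-drop i ws′ j = agree (i + j)

prefixLe-agree : ∀ {M u ws ws′} → All (_≤ M) u → length ws ≡ length ws′ → AgreeAbove M ws ws′ →
                 prefixLe u ws ≡ prefixLe u ws′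
prefixLe-agree {u = []}                              _           _   _     = refl
prefixLe-agree {u = _ ∷ _} {[]}     {[]}             _           _   _     = refl
prefixLe-agree {u = x ∷ u} {w ∷ ws} {w′ ∷ ws′} (x≤M ∷ u≤M) len agree =
  cong₂ _∧_ head (prefixLe-agree u≤M (suc-injective len) (agree ∘ suc))
  where
  head : (x ≤ᵇ w) ≡ (x ≤ᵇ w′)
  head with agree 0
  ... | inj₁ w≡w′          = cong (x ≤ᵇ_) w≡w′
  ... | inj₂ (M≤w , M≤w′) = T-ext (λ _ → ≤⇒≤ᵇ (≤-trans x≤M M≤w′)) (λ _ → ≤⇒≤ᵇ (≤-trans x≤M M≤w))

factorLe⇒prefixLe-drop : ∀ u ws → T (factorLe u ws) → ∃ λ i → T (prefixLe u (drop i ws))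
factorLe⇒prefixLe-drop u []       h = 0 , h
factorLe⇒prefixLe-drop u (y ∷ ws) h with Equivalence.to (T-∨ {prefixLe u (y ∷ ws)}) h
... | inj₁ now   = 0 , now
... | inj₂ later = let i , h′ = factorLe⇒prefixLe-drop u ws later in suc i , h′

prefixLe-drop⇒factorLe : ∀ u ws i → T (prefixLe u (drop i ws)) → T (factorLe u ws)
prefixLe-drop⇒factorLe u []       zero    h = h
prefixLe-drop⇒factorLe u []       (suc i) h = h
prefixLe-drop⇒factorLe u (y ∷ ws) zero    h = Equivalence.from T-∨ (inj₁ h)
prefixLe-drop⇒factorLe u (y ∷ ws) (suc i) h = Equivalence.from T-∨ (inj₂ (prefixLe-drop⇒factorLe u ws i h))

-- With r marking the anchors, aheadF f i counts the anchors i, i + d, i + 2d, … (using fuel f) and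
-- behind i the anchors i ∸ d, i ∸ 2d, …; the chain through i thus covers the positions
-- i ∸ behind i * d, …, i + aheadF N i * d, and reflect N mirrors i within it. The fuel N must
-- exceed every anchor.
module Chains (r : ℕ → Bool) (d : ℕ) where

  aheadF : ℕ → ℕ → ℕ
  aheadF zero    i = 0
  aheadF (suc f) i = if r i then suc (aheadF f (i + d)) else 0

  behindF : ℕ → ℕ → ℕ
  behindF zero    i = 0
  behindF (suc f) i = if (d ≤ᵇ i) ∧ r (i ∸ d) then suc (behindF f (i ∸ d)) else 0

  behind : ℕ → ℕ
  behind i = behindF i i

  reflect : ℕ → ℕ → ℕ
  reflect N i = i + aheadF N i * d ∸ behind i * d

open Chains using (reflect)

aheadF-cong : ∀ {r r'} d → (∀ i → r i ≡ r' i) → ∀ f i → Chains.aheadF r d f i ≡ Chains.aheadF r' d f i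
aheadF-cong d r≗r' zero    i = refl
aheadF-cong {r' = r'} d r≗r' (suc f) i rewrite r≗r' i with r' i
... | true  = cong suc (aheadF-cong d r≗r' f (i + d))
... | false = refl

behindF-cong : ∀ {r r'} d → (∀ i → r i ≡ r' i) → ∀ f i → Chains.behindF r d f i ≡ Chains.behindF r' d f i
behindF-cong d r≗r' zero    i = refl
behindF-cong {r' = r'} d r≗r' (suc f) i rewrite r≗r' (i ∸ d) with (d ≤ᵇ i) ∧ r' (i ∸ d)
... | true  = cong suc (behindF-cong d r≗r' f (i ∸ d))
... | false = refl

reflect-cong : ∀ {r r'} d N → (∀ i → r i ≡ r' i) → ∀ i → reflect r d N i ≡ reflect r' d N i
reflect-cong d N r≗r' i =
  cong₂ (λ x y → i + x * d ∸ y * d) (aheadF-cong d r≗r' N i) (behindF-cong d r≗r' i i)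

module ChainReflection (r : ℕ → Bool) (d N : ℕ) (0<d : 0 < d)
                       (bound : ∀ i → T (r i) → i + d < N) where

  open Chains r d using (aheadF; behindF; behind)

  ahead : ℕ → ℕ
  ahead = aheadF N

  σ : ℕ → ℕ
  σ = reflect r d N

  ¬anchor-beyond : ∀ {i} → N ≤ i → ¬ T (r i)
  ¬anchor-beyond N≤i ri = <⇒≱ (bound _ ri) (≤-trans N≤i (m≤m+n _ d))

  aheadF-¬anchor : ∀ f i → ¬ T (r i) → aheadF f i ≡ 0
  aheadF-¬anchor zero    i _ = refl
  aheadF-¬anchor (suc f) i ¬ri with r i | ¬ri
  ... | false | _   = refl
  ... | true  | ¬ri = ⊥-elim (¬ri _)

  aheadF-fuel : ∀ f g i → N ≤ i + f → N ≤ i + g → aheadF f i ≡ aheadF g i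
  aheadF-fuel zero g i p _ =
    sym (aheadF-¬anchor g i (¬anchor-beyond (subst (N ≤_) (+-identityʳ i) p)))
  aheadF-fuel (suc f) zero i _ q =
    aheadF-¬anchor (suc f) i (¬anchor-beyond (subst (N ≤_) (+-identityʳ i) q))
  aheadF-fuel (suc f) (suc g) i p q with r i
  ... | false = refl
  ... | true  = cong suc (aheadF-fuel f g (i + d) (step f p) (step g q))
    where
    step : ∀ f → N ≤ i + suc f → N ≤ i + d + f
    step f p = ≤-trans p (≤-trans (≤-reflexive (+-suc i f)) (+-monoˡ-≤ f (m<m+n i 0<d)))

  aheadF-anchor : ∀ f {i} → T (r i) → aheadF (suc f) i ≡ suc (aheadF f (i + d))
  aheadF-anchor f {i} ri with r i | ri
  ... | true | _ = refl

  ahead-anchor : ∀ {i} → T (r i) → ahead i ≡ suc (ahead (i + d))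
  ahead-anchor {i} ri = begin
    aheadF N i              ≡⟨ aheadF-fuel N (suc N) i (m≤n+m N i) (≤-trans (n≤1+n N) (m≤n+m (suc N) i)) ⟩
    aheadF (suc N) i        ≡⟨ aheadF-anchor N ri ⟩
    suc (aheadF N (i + d))  ∎
    where open ≡-Reasoning

  ahead-suc⁻ : ∀ {i t} → ahead i ≡ suc t → T (r i) × ahead (i + d) ≡ t
  ahead-suc⁻ {i} e with T? (r i)
  ... | yes ri  = ri , suc-injective (trans (sym (ahead-anchor ri)) e)
  ... | no  ¬ri with () ← trans (sym (aheadF-¬anchor N i ¬ri)) e

  behindF-below : ∀ f i → i < d → behindF f i ≡ 0
  behindF-below zero    i _   = refl
  behindF-below (suc f) i i<d with d ≤ᵇ i | ≤ᵇ⇒≤ d i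
  ... | false | _   = refl
  ... | true  | d≤i = ⊥-elim (<⇒≱ i<d (d≤i _))

  behindF-fuel : ∀ f g i → i ≤ f → i ≤ g → behindF f i ≡ behindF g i
  behindF-fuel zero    g       .0 z≤n _   = sym (behindF-below g 0 0<d)
  behindF-fuel (suc f) zero    .0 _   z≤n = behindF-below (suc f) 0 0<d
  behindF-fuel (suc f) (suc g) i  p   q with (d ≤ᵇ i) ∧ r (i ∸ d)
  ... | false = refl
  ... | true  = cong suc (behindF-fuel f g (i ∸ d) (step p) (step q))
    where
    step : ∀ {f} → i ≤ suc f → i ∸ d ≤ f
    step p = ≤-trans (∸-monoʳ-≤ i 0<d) (∸-monoˡ-≤ 1 p)

  behindF-anchor : ∀ f {i} → T (r i) → behindF (suc f) (i + d) ≡ suc (behindF f i)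
  behindF-anchor f {i} ri with d ≤ᵇ i + d | ≤⇒≤ᵇ (m≤n+m d i) | i + d ∸ d | m+n∸n≡m i d
  ... | true | _ | .i | refl with r i | ri
  ... | true | _ = refl

  behind-anchor : ∀ {i} → T (r i) → behind (i + d) ≡ suc (behind i)
  behind-anchor {i} ri = begin
    behindF (i + d) (i + d)        ≡⟨ behindF-fuel (i + d) (suc (i + d)) (i + d) ≤-refl (n≤1+n _) ⟩
    behindF (suc (i + d)) (i + d)  ≡⟨ behindF-anchor (i + d) ri ⟩
    suc (behindF (i + d) i)        ≡⟨ cong suc (behindF-fuel (i + d) i i (m≤m+n i d) ≤-refl) ⟩
    suc (behindF i i)              ∎
    where open ≡-Reasoning

  behind-suc⁻ : ∀ {i t} → behind i ≡ suc t → d ≤ i × T (r (i ∸ d)) × behind (i ∸ d) ≡ t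
  behind-suc⁻ {suc i} e with d ≤ᵇ suc i | ≤ᵇ⇒≤ d (suc i) | r (suc i ∸ d)
  ... | true | d≤i | true =
    d≤i _ , _ ,
    trans (behindF-fuel (suc i ∸ d) i (suc i ∸ d) ≤-refl (∸-monoʳ-≤ (suc i) 0<d)) (suc-injective e)

  ahead-walk : ∀ t j → t ≤ ahead j → ahead (j + t * d) ≡ ahead j ∸ t × behind (j + t * d) ≡ behind j + t
  ahead-walk zero    j _ =
    cong ahead (+-identityʳ j) , trans (cong behind (+-identityʳ j)) (sym (+-identityʳ _))
  ahead-walk (suc t) j p with ahead j in e
  ... | suc a with ahead-suc⁻ e
  ... | rj , a≡ with ahead-walk t (j + d) (subst (t ≤_) (sym a≡) (s≤s⁻¹ p))
  ... | ah , bh rewrite +-assoc j d (t * d) =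
    trans ah (cong (_∸ t) a≡) , trans bh (trans (cong (_+ t) (behind-anchor rj)) (sym (+-suc _ t)))

  behind-walk : ∀ t j → t ≤ behind j →
    t * d ≤ j × ahead (j ∸ t * d) ≡ ahead j + t × behind (j ∸ t * d) ≡ behind j ∸ t
  behind-walk zero    j _ = z≤n , sym (+-identityʳ _) , refl
  behind-walk (suc t) j p with behind j in e
  ... | suc b with behind-suc⁻ e
  ... | d≤j , rj , b≡ with behind-walk t (j ∸ d) (subst (t ≤_) (sym b≡) (s≤s⁻¹ p))
  ... | td≤ , ah , bh rewrite ∸-+-assoc j d (t * d) =
    subst (d + t * d ≤_) (m+[n∸m]≡n d≤j) (+-monoʳ-≤ d td≤) ,
    trans ah (trans (cong (_+ t) ahead-back) (sym (+-suc _ t))) ,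
    trans bh (cong (_∸ t) b≡)
    where
    ahead-back : ahead (j ∸ d) ≡ suc (ahead j)
    ahead-back = trans (ahead-anchor rj) (cong (suc ∘ ahead) (m∸n+n≡m d≤j))

  reflect-from-start : ∀ i → σ i ≡ i ∸ behind i * d + ahead i * d
  reflect-from-start i = +-∸-comm (ahead i * d) (proj₁ (behind-walk (behind i) i ≤-refl))

  reflect-swap : ∀ i → ahead (σ i) ≡ behind i × behind (σ i) ≡ ahead i
  reflect-swap i with behind-walk (behind i) i ≤-refl
  ... | _ , ah₀ , bh₀
    with ahead-walk (ahead i) (i ∸ behind i * d) (subst (ahead i ≤_) (sym ah₀) (m≤m+n _ _))
  ... | ah , bh rewrite sym (reflect-from-start i) =
    trans ah (trans (cong (_∸ ahead i) ah₀) (m+n∸m≡n (ahead i) (behind i))) ,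
    trans bh (cong (_+ ahead i) (trans bh₀ (n∸n≡0 (behind i))))

  reflect-involutive : ∀ i → σ (σ i) ≡ i
  reflect-involutive i = begin
    σ i + ahead (σ i) * d ∸ behind (σ i) * d  ≡⟨ cong₂ (λ x y → σ i + x * d ∸ y * d) ah bh ⟩
    σ i + bd ∸ ad                             ≡⟨ cong (λ z → z + bd ∸ ad) (reflect-from-start i) ⟩
    s + ad + bd ∸ ad                          ≡⟨ cong (_∸ ad) (+-assoc s ad bd) ⟩
    s + (ad + bd) ∸ ad                        ≡⟨ cong (λ z → s + z ∸ ad) (+-comm ad bd) ⟩
    s + (bd + ad) ∸ ad                        ≡⟨ cong (_∸ ad) (sym (+-assoc s bd ad)) ⟩
    s + bd + ad ∸ ad                          ≡⟨ m+n∸n≡m (s + bd) ad ⟩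
    s + bd                                    ≡⟨ m∸n+n≡m (proj₁ (behind-walk (behind i) i ≤-refl)) ⟩
    i                                         ∎
    where
    open ≡-Reasoning
    ad = ahead i * d
    bd = behind i * d
    s  = i ∸ bd
    ah = proj₁ (reflect-swap i)
    bh = proj₂ (reflect-swap i)

  reflect-anchor : ∀ {i} → T (r i) → T (r (σ (i + d)))
  reflect-anchor {i} ri =
    proj₁ (ahead-suc⁻ (trans (proj₁ (reflect-swap (i + d))) (behind-anchor ri)))

  reflect-anchor⁻ : ∀ {j} → T (r j) → ∃ λ i → T (r i) × σ (i + d) ≡ j
  reflect-anchor⁻ {j} rj with behind-suc⁻ (trans (proj₂ (reflect-swap j)) (ahead-anchor rj))
  ... | d≤ , ri , _ = σ j ∸ d , ri , trans (cong σ (m∸n+n≡m d≤)) (reflect-involutive j)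

  InChain : ℕ → Set
  InChain i = T (r i) ⊎ (d ≤ i × T (r (i ∸ d)))

  reflect-fixes-outside : ∀ i → σ i ≡ i ⊎ InChain i
  reflect-fixes-outside i with ahead i in ea | behind i in eb
  ... | suc _ | _     = inj₂ (inj₁ (proj₁ (ahead-suc⁻ ea)))
  ... | zero  | suc _ = let d≤i , ri , _ = behind-suc⁻ eb in inj₂ (inj₂ (d≤i , ri))
  ... | zero  | zero  = inj₁ (+-identityʳ i)

  reflect-moves-within-chains : ∀ i → σ i ≡ i ⊎ (InChain i × InChain (σ i))
  reflect-moves-within-chains i with reflect-fixes-outside i | reflect-fixes-outside (σ i)
  ... | inj₁ fixed | _          = inj₁ fixed
  ... | inj₂ _     | inj₁ fixed = inj₁ (trans (sym fixed) (reflect-involutive i))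
  ... | inj₂ ci    | inj₂ cσi   = inj₂ (ci , cσi)

  reflect-≤ : ∀ {i} → ahead i ≡ 0 → σ i ≤ i
  reflect-≤ {i} e rewrite e | +-identityʳ i = m∸n≤m i (behind i * d)

  reflect-< : ∀ {i} → i < N → σ i < N
  reflect-< {i} i<N with T? (r i)
  ... | no ¬ri = ≤-<-trans (reflect-≤ (aheadF-¬anchor N i ¬ri)) i<N
  ... | yes ri with behind-suc⁻ (trans (proj₂ (reflect-swap i)) (ahead-anchor ri))
  ... | d≤ , rσ , _ = subst (_< N) (m∸n+n≡m d≤) (bound _ rσ)

module Swap (m : ℕ) (1≤m : 1 ≤ m) (a b c : List ℕ) (abc≤m : All (_≤ m) (a ++ m ∷ b ++ m ∷ c)) where

  k d : ℕ
  k = length a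
  d = suc (length b)

  motif : ℕ → ℕ → List ℕ
  motif x y = a ++ x ∷ b ++ y ∷ c

  motif-split : ∀ x y → motif x y ≡ (a ++ x ∷ b) ++ y ∷ c
  motif-split x y = sym (++-assoc a (x ∷ b) (y ∷ c))

  module _ {x y : ℕ} {ws : List ℕ} where

    motif-first : T (prefixLe (motif x y) ws) → x ≤ at ws k
    motif-first = prefixLe-at a

    motif-second : T (prefixLe (motif x y) ws) → y ≤ at ws (k + d)
    motif-second h = subst (λ j → y ≤ at ws j) (length-++ a)
                           (prefixLe-at (a ++ x ∷ b) (subst (λ u → T (prefixLe u ws)) (motif-split x y) h))

  motif-replace : ∀ {x y x′ y′ ws} → T (prefixLe (motif x y) ws) →
                  x′ ≤ at ws k → y′ ≤ at ws (k + d) → T (prefixLe (motif x′ y′) ws)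
  motif-replace {x} {y} {x′} {y′} {ws} h x′≤ y′≤ =
    subst (λ u → T (prefixLe u ws)) (sym (motif-split x′ y′))
      (prefixLe-replace (a ++ x′ ∷ b)
        (subst (λ u → T (prefixLe u ws)) (motif-split x′ y) (prefixLe-replace a h x′≤))
        (subst (λ j → y′ ≤ at ws j) (sym (length-++ a)) y′≤))

  -- p is the position of the first distinguished letter of an occurrence of motif m m;
  -- the second one then sits at p + d.
  anchored : List ℕ → ℕ → Bool
  anchored w p = (k ≤ᵇ p) ∧ prefixLe (motif m m) (drop (p ∸ k) w)

  anchored-intro : ∀ w i → T (prefixLe (motif m m) (drop i w)) → T (anchored w (i + k))
  anchored-intro w i h rewrite m+n∸n≡m i k = Equivalence.from T-∧ (≤⇒≤ᵇ (m≤n+m k i) , h)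

  anchored-elim : ∀ w p → T (anchored w p) → k ≤ p × T (prefixLe (motif m m) (drop (p ∸ k) w))
  anchored-elim w p h with k≤p , h′ ← Equivalence.to T-∧ h = ≤ᵇ⇒≤ k p k≤p , h′

  at-anchor : ∀ w {p} → k ≤ p →
              at (drop (p ∸ k) w) k ≡ at w p × at (drop (p ∸ k) w) (k + d) ≡ at w (p + d)
  at-anchor w {p} k≤p =
    trans (at-drop (p ∸ k) w k) (cong (at w) (m∸n+n≡m k≤p)) ,
    trans (at-drop (p ∸ k) w (k + d))
          (cong (at w) (trans (sym (+-assoc (p ∸ k) k d)) (cong (_+ d) (m∸n+n≡m k≤p))))

  anchored-letters : ∀ w p → T (anchored w p) → m ≤ at w p × m ≤ at w (p + d)
  anchored-letters w p h
    with k≤p , h′ ← anchored-elim w p h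
    with first , second ← at-anchor w k≤p =
    subst (m ≤_) first (motif-first h′) , subst (m ≤_) second (motif-second h′)

  anchored-bound : ∀ w p → T (anchored w p) → p + d < length w
  anchored-bound w p h = at-positive w (p + d) (≤-trans 1≤m (proj₂ (anchored-letters w p h)))

  Occurs : ℕ → ℕ → List ℕ → Set
  Occurs x y w = ∃ λ p → T (anchored w p) × x ≤ at w p × y ≤ at w (p + d)

  factorLe⇒Occurs : ∀ {x y} w → m ≤ x → m ≤ y → T (factorLe (motif x y) w) → Occurs x y w
  factorLe⇒Occurs w m≤x m≤y h with i , hᵢ ← factorLe⇒prefixLe-drop _ w h =
    i + k ,
    anchored-intro w i (motif-replace hᵢ (≤-trans m≤x (motif-first hᵢ)) (≤-trans m≤y (motif-second hᵢ))) ,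
    subst (_ ≤_) (at-drop i w k) (motif-first hᵢ) ,
    subst (_ ≤_) (trans (at-drop i w (k + d)) (cong (at w) (sym (+-assoc i k d)))) (motif-second hᵢ)

  Occurs⇒factorLe : ∀ {x y} w → Occurs x y w → T (factorLe (motif x y) w)
  Occurs⇒factorLe w (p , anch , x≤ , y≤)
    with k≤p , h ← anchored-elim w p anch
    with first , second ← at-anchor w k≤p =
    prefixLe-drop⇒factorLe _ w (p ∸ k)
      (motif-replace h (subst (_ ≤_) (sym first) x≤) (subst (_ ≤_) (sym second) y≤))

  σ : List ℕ → ℕ → ℕ
  σ w = Chains.reflect (anchored w) d (length w)

  φ : List ℕ → List ℕ
  φ w = permute (σ w) w

  module Reflect (w : List ℕ) = ChainReflection (anchored w) d (length w) (s≤s z≤n) (anchored-bound w)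

  InChain-letter : ∀ w {j} → Reflect.InChain w j → m ≤ at w j
  InChain-letter w {j} (inj₁ anch)        = proj₁ (anchored-letters w j anch)
  InChain-letter w {j} (inj₂ (d≤j , anch)) =
    subst (λ i → m ≤ at w i) (m∸n+n≡m d≤j) (proj₂ (anchored-letters w (j ∸ d) anch))

  φ-agree : ∀ w → AgreeAbove m (φ w) w
  φ-agree w j with j <? length w
  ... | no  j≮ = inj₁ (trans (at-beyond (φ w) (subst (_≤ j) (sym (length-permute (σ w) w)) (≮⇒≥ j≮)))
                             (sym (at-beyond w (≮⇒≥ j≮))))
  ... | yes j< rewrite at-permute (σ w) w j< with Reflect.reflect-moves-within-chains w j
  ...   | inj₁ fixed       = inj₁ (cong (at w) fixed)
  ...   | inj₂ (cj , cσj) = inj₂ (InChain-letter w cσj , InChain-letter w cj)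

  anchored-φ : ∀ w p → anchored (φ w) p ≡ anchored w p
  anchored-φ w p = cong ((k ≤ᵇ p) ∧_) (prefixLe-agree abc≤m same-length (AgreeAbove-drop i (φ-agree w)))
    where
    open ≡-Reasoning
    i = p ∸ k
    same-length : length (drop i (φ w)) ≡ length (drop i w)
    same-length = begin
      length (drop i (φ w))  ≡⟨ length-drop i (φ w) ⟩
      length (φ w) ∸ i       ≡⟨ cong (_∸ i) (length-permute (σ w) w) ⟩
      length w ∸ i           ≡⟨ length-drop i w ⟨
      length (drop i w)      ∎

  σ-φ : ∀ w j → σ (φ w) j ≡ σ w j
  σ-φ w j = trans (reflect-cong d (length (φ w)) (anchored-φ w) j)
                  (cong (λ N → Chains.reflect (anchored w) d N j) (length-permute (σ w) w))

  φ-involutive : ∀ w → φ (φ w) ≡ w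
  φ-involutive w = trans (permute-cong (σ-φ w) (φ w))
                         (permute-involutive (Reflect.reflect-involutive w) (Reflect.reflect-< w))

  φ-↭ : ∀ w → φ w ↭ w
  φ-↭ w = permute-↭ (Reflect.reflect-involutive w) (Reflect.reflect-< w)

  at-φ-anchor : ∀ w {p} → T (anchored w p) → at (φ w) (p + d) ≡ at w (σ w (p + d))
  at-φ-anchor w {p} anch = at-permute (σ w) w (anchored-bound w p anch)

  module _ {n : ℕ} where

    Occurs-φ : ∀ w → Occurs m n (φ w) → Occurs n m w
    Occurs-φ w (p , anchφ , _ , n≤) =
      σ w (p + d) , anch′ , subst (n ≤_) (at-φ-anchor w anch) n≤ , proj₂ (anchored-letters w _ anch′)
      where
      anch  = subst T (anchored-φ w p) anchφ
      anch′ = Reflect.reflect-anchor w anch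

    Occurs-φ⁻ : ∀ w → Occurs n m w → Occurs m n (φ w)
    Occurs-φ⁻ w (p′ , anch′ , n≤ , _) with p , anch , σ≡ ← Reflect.reflect-anchor⁻ w anch′ =
      p , anchφ , proj₁ (anchored-letters (φ w) p anchφ) ,
      subst (n ≤_) (sym (trans (at-φ-anchor w anch) (cong (at w) σ≡))) n≤
      where
      anchφ = subst T (sym (anchored-φ w p)) anch

  factorLe-φ : ∀ {n} → m ≤ n → ∀ w → factorLe (motif m n) (φ w) ≡ factorLe (motif n m) w
  factorLe-φ m≤n w = T-ext
    (Occurs⇒factorLe w ∘ Occurs-φ w ∘ factorLe⇒Occurs (φ w) ≤-refl m≤n)
    (Occurs⇒factorLe (φ w) ∘ Occurs-φ⁻ w ∘ factorLe⇒Occurs w m≤n ≤-refl)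

theorem4p3 : (m n : ℕ) → 1 ≤ m → m < n → (a b c : List ℕ) →
  InRange m a → InRange m b → InRange m c →
  WilfEquiv (a ++ m ∷ b ++ n ∷ c) (a ++ n ∷ b ++ m ∷ c)
theorem4p3 m n 1≤m m<n a b c a∈ b∈ c∈ ℓ s =
  count-invariant (involution-↭ (words-unique ℓ s) φ-involutive (words-↭ {ℓ} {s} (φ-↭ _)))
                  (factorLe-φ (<⇒≤ m<n))
  where
  letters≤m : All (_≤ m) (a ++ m ∷ b ++ m ∷ c)
  letters≤m = ++⁺ (All.map proj₂ a∈) (≤-refl ∷ ++⁺ (All.map proj₂ b∈) (≤-refl ∷ All.map proj₂ c∈))
  open Swap m 1≤m a b c letters≤m
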